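{- Let $V$ be a finite-dimensional vector space, $\mathcal{X}=(X_1,\dots,X_n)$ a family of subspaces of $V$, and $M$ the $q$-matroid on $V$ whose independent subspaces are the partial $q$-transversals of $\mathcal{X}$. Then for each $1\le i\le n$, the subspace $X_i$ is a flat of $M$.
   Context: A $q$-matroid on $V$ is given by a rank function $r$ on subspaces with $0\le r(A)\le\dim A$, monotone and submodular; a subspace $A$ is independent if $r(A)=\dim A$. A partial $q$-transversal of $\mathcal{X}$ is a subspace $T$ such that every vector basis $B$ of $T$ admits an injection $\pi:B\to\{1,\dots,n\}$ with $b\notin X_{\pi(b)}$ for all $b\in B$ (these form the independent subspaces of a $q$-matroid). The closure of a subspace $A$ is the largest subspace $B$ with $A\le B\le V$ and $r(B)=r(A)$; $A$ is a flat if it equals its closure, equivalently $r(Y)>r(A)$ for every subspace $Y\ge A$ with $\dim Y=\dim A+1$. -}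

module Defs where

open import Level using (Level; _⊔_)
open import Data.Nat as ℕ using (ℕ; zero; suc; _<_; _≤_)
open import Data.Fin using (Fin; zero; suc)
open import Data.Product using (Σ; ∃; _×_; _,_)
open import Relation.Nullary using (¬_)
open import Relation.Binary.Definitions using (Decidable)
open import Relation.Binary.PropositionalEquality using (_≡_)
open import Function.Definitions using (Injective)
open import Algebra.Bundles using (CommutativeRing)

record Field (c ℓ : Level) : Set (Level.suc (c ⊔ ℓ)) where
  field
    commRing : CommutativeRing c ℓ
  open CommutativeRing commRing public
  field
    _≟_      : Decidable _≈_
    1≉0      : ¬ (1# ≈ 0#)
    inverse  : ∀ x → ¬ (x ≈ 0#) → Σ Carrier (λ y → (x * y) ≈ 1#)

module LinAlg {c ℓ : Level} (F : Field c ℓ) (m : ℕ) where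
  open Field F using (Carrier; _≈_; _+_; _*_; 0#; 1#)

  V : Set c
  V = Fin m → Carrier

  _≈ᵥ_ : V → V → Set ℓ
  u ≈ᵥ v = ∀ k → u k ≈ v k

  0ᵥ : V
  0ᵥ _ = 0#

  _+ᵥ_ : V → V → V
  (u +ᵥ v) k = u k + v k

  _·ᵥ_ : Carrier → V → V
  (a ·ᵥ v) k = a * v k

  lincomb : ∀ {j} → (Fin j → Carrier) → (Fin j → V) → V
  lincomb {zero}  a vs = 0ᵥ
  lincomb {suc j} a vs = (a zero ·ᵥ vs zero) +ᵥ lincomb (λ k → a (suc k)) (λ k → vs (suc k))

  record Subspace : Set (Level.suc (c ⊔ ℓ)) where
    field
      _∈S   : V → Set (c ⊔ ℓ)
      resp  : ∀ {u v} → u ≈ᵥ v → u ∈S → v ∈S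
      0∈    : 0ᵥ ∈S
      +∈    : ∀ {u v} → u ∈S → v ∈S → (u +ᵥ v) ∈S
      ·∈    : ∀ a {v} → v ∈S → (a ·ᵥ v) ∈S
  open Subspace public

  _∈_ : V → Subspace → Set (c ⊔ ℓ)
  v ∈ A = _∈S A v

  _⊑_ : Subspace → Subspace → Set (c ⊔ ℓ)
  A ⊑ B = ∀ v → v ∈ A → v ∈ B

  LinIndep : ∀ {j} → (Fin j → V) → Set (c ⊔ ℓ)
  LinIndep {j} vs = ∀ (a : Fin j → Carrier) → lincomb a vs ≈ᵥ 0ᵥ → ∀ k → a k ≈ 0#

  Spans : ∀ {j} → (Fin j → V) → Subspace → Set (c ⊔ ℓ)
  Spans {j} vs A = ∀ v → (v ∈ A → Σ (Fin j → Carrier) (λ a → lincomb a vs ≈ᵥ v))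
                       × (Σ (Fin j → Carrier) (λ a → lincomb a vs ≈ᵥ v) → v ∈ A)

  IsBasis : Subspace → ∀ j → (Fin j → V) → Set (c ⊔ ℓ)
  IsBasis A j vs = LinIndep vs × Spans vs A

  HasDim : Subspace → ℕ → Set (c ⊔ ℓ)
  HasDim A d = Σ (Fin d → V) (λ vs → IsBasis A d vs)

  module Transversal {n : ℕ} (X : Fin n → Subspace) where

    PartialQTransversal : Subspace → Set (c ⊔ ℓ)
    PartialQTransversal T =
      ∀ j (bs : Fin j → V) → IsBasis T j bs →
        Σ (Fin j → Fin n) (λ π → Injective _≡_ _≡_ π × (∀ k → ¬ (bs k ∈ X (π k))))

    Independent : Subspace → Set (c ⊔ ℓ)
    Independent = PartialQTransversal

    HasRank : Subspace → ℕ → Set (Level.suc (c ⊔ ℓ))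
    HasRank A k =
      (Σ Subspace (λ T → T ⊑ A × Independent T × HasDim T k))
      × (∀ T j → T ⊑ A → Independent T → HasDim T j → j ≤ k)

    IsFlat : Subspace → Set (Level.suc (c ⊔ ℓ))
    IsFlat A = ∀ (Y : Subspace) (d k k′ : ℕ) → A ⊑ Y → HasDim A d → HasDim Y (suc d)
               → HasRank A k → HasRank Y k′ → k < k′

{-# OPTIONS --safe #-}
-- Let T ≤ X i be a partial q-transversal with dim T = r(X i). As dim Y > dim X i, some basis
-- vector y of Y lies outside X i; we show that T′ = T + ⟨y⟩ ≤ Y is again a partial
-- q-transversal, whence r(Y) > r(X i). Let b be a basis of T′ and b l₀ ∉ X i. Eliminating the
-- y-coordinate of the other vectors against b l₀ gives a basis of T, hence an injection π₀
-- avoiding i (as T ≤ X i), which we extend to φ by l₀ ↦ i. Now φ need not satisfy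
-- b l ∉ X (φ l), but it maps every set S of indices into N S = {j | b l ∉ X j for some l ∈ S},
-- provided l₀ is chosen in S whenever possible; so Hall's marriage theorem applies.
-- Constructively, membership in a subspace is only decidable up to double negation, which is
-- enough because the conclusion r(X i) < r(Y) is decidable.
module Submission where

open import Defs
open import Level using (Level; _⊔_)
open import Data.Nat using (ℕ; zero; suc; _≤_; _<_; z≤n; s≤s; _<?_; _≤?_)
open import Data.Fin as Fin using (Fin; zero; suc; punchIn; punchOut)
open import Data.Fin.Properties using (any?)
open import Data.Product using (Σ; ∃; _×_; _,_; proj₁; proj₂)
open import Data.Sum using (_⊎_; inj₁; inj₂)
open import Function using (_∘_)
open import Function.Definitions using (Injective)
open import Relation.Binary.PropositionalEquality as ≡ using (_≡_; _≢_)
open import Relation.Nullary using (Dec; yes; no; ¬_; contradiction)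
open import Relation.Nullary.Decidable using (_×-dec_; ¬?; decidable-stable)
open import Relation.Nullary.Negation using (¬¬-map)

module SubsetCardinality where
  open import Data.Nat using (_+_)
  open import Data.Nat.Properties using (+-suc; +-identityʳ; m≤m+n; ≤-<-trans; n>0⇒n≢0)
  open import Data.Fin.Properties using (suc-injective; 0≢1+n)
  open import Data.Fin.Subset
  open import Data.Fin.Subset.Properties
  open import Data.Vec using (_∷_; []; here; there)
  open ≡ using (refl; sym; trans; cong; subst; module ≡-Reasoning)

  private variable
    n : ℕ
    p : Subset n
    x : Fin n

  ∣p∪q∣+∣p∩q∣≡∣p∣+∣q∣ : (p q : Subset n) → ∣ p ∪ q ∣ + ∣ p ∩ q ∣ ≡ ∣ p ∣ + ∣ q ∣
  ∣p∪q∣+∣p∩q∣≡∣p∣+∣q∣ []            []            = refl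
  ∣p∪q∣+∣p∩q∣≡∣p∣+∣q∣ (inside ∷ p)  (inside ∷ q)  =
    cong suc (trans (+-suc _ _) (trans (cong suc (∣p∪q∣+∣p∩q∣≡∣p∣+∣q∣ p q)) (sym (+-suc _ _))))
  ∣p∪q∣+∣p∩q∣≡∣p∣+∣q∣ (inside ∷ p)  (outside ∷ q) = cong suc (∣p∪q∣+∣p∩q∣≡∣p∣+∣q∣ p q)
  ∣p∪q∣+∣p∩q∣≡∣p∣+∣q∣ (outside ∷ p) (inside ∷ q)  =
    trans (cong suc (∣p∪q∣+∣p∩q∣≡∣p∣+∣q∣ p q)) (sym (+-suc _ _))
  ∣p∪q∣+∣p∩q∣≡∣p∣+∣q∣ (outside ∷ p) (outside ∷ q) = ∣p∪q∣+∣p∩q∣≡∣p∣+∣q∣ p q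

  ∣p∪q∣≤∣p∣+∣q∣ : (p q : Subset n) → ∣ p ∪ q ∣ ≤ ∣ p ∣ + ∣ q ∣
  ∣p∪q∣≤∣p∣+∣q∣ p q = subst (∣ p ∪ q ∣ ≤_) (∣p∪q∣+∣p∩q∣≡∣p∣+∣q∣ p q) (m≤m+n _ _)

  Empty⇒∣p∣≡0 : Empty p → ∣ p ∣ ≡ 0
  Empty⇒∣p∣≡0 {n} p-empty = trans (cong ∣_∣ (Empty-unique p-empty)) (∣⊥∣≡0 n)

  Empty[p∩q]⇒∣p∪q∣≡∣p∣+∣q∣ : (p q : Subset n) → Empty (p ∩ q) → ∣ p ∪ q ∣ ≡ ∣ p ∣ + ∣ q ∣
  Empty[p∩q]⇒∣p∪q∣≡∣p∣+∣q∣ p q disjoint = begin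
    ∣ p ∪ q ∣                ≡⟨ +-identityʳ _ ⟨
    ∣ p ∪ q ∣ + 0            ≡⟨ cong (∣ p ∪ q ∣ +_) (Empty⇒∣p∣≡0 disjoint) ⟨
    ∣ p ∪ q ∣ + ∣ p ∩ q ∣    ≡⟨ ∣p∪q∣+∣p∩q∣≡∣p∣+∣q∣ p q ⟩
    ∣ p ∣ + ∣ q ∣            ∎
    where open ≡-Reasoning

  Nonempty⇒0<∣p∣ : Nonempty p → 0 < ∣ p ∣
  Nonempty⇒0<∣p∣ (_ , x∈p) = ≤-<-trans z≤n (x∈p⇒∣p-x∣<∣p∣ x∈p)

  0<∣p∣⇒Nonempty : 0 < ∣ p ∣ → Nonempty p
  0<∣p∣⇒Nonempty {p = p} 0<∣p∣ with nonempty? p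
  ... | yes p-nonempty = p-nonempty
  ... | no  p-empty    = contradiction (Empty⇒∣p∣≡0 p-empty) (n>0⇒n≢0 0<∣p∣)

  x∈p⇒⁅x⁆⊆p : x ∈ p → ⁅ x ⁆ ⊆ p
  x∈p⇒⁅x⁆⊆p {p = p} x∈p y∈⁅x⁆ = subst (_∈ p) (sym (x∈⁅y⁆⇒x≡y _ y∈⁅x⁆)) x∈p

  x∈p─q⇒x∉q : (p q : Subset n) → x ∈ p ─ q → x ∉ q
  x∈p─q⇒x∉q (_ ∷ p)      (inside ∷ q)  ()         here
  x∈p─q⇒x∉q (inside ∷ p) (outside ∷ q) here       ()
  x∈p─q⇒x∉q (_ ∷ p)      (_ ∷ q)       (there x∈) (there x∈q) = x∈p─q⇒x∉q p q x∈ x∈q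

  injective⇒∣p∣≤∣q∣ : ∀ {m} {f : Fin m → Fin n} → Injective _≡_ _≡_ f →
                      (p : Subset m) (q : Subset n) → (∀ {x} → x ∈ p → f x ∈ q) → ∣ p ∣ ≤ ∣ q ∣
  injective⇒∣p∣≤∣q∣ f-injective []            q f[p]⊆q = z≤n
  injective⇒∣p∣≤∣q∣ f-injective (outside ∷ p) q f[p]⊆q =
    injective⇒∣p∣≤∣q∣ (suc-injective ∘ f-injective) p q (f[p]⊆q ∘ there)
  injective⇒∣p∣≤∣q∣ {f = f} f-injective (inside ∷ p) q f[p]⊆q = ≤-<-trans
    (injective⇒∣p∣≤∣q∣ (suc-injective ∘ f-injective) p (q - f zero)
      (λ x∈p → x∈p∧x≢y⇒x∈p-y (f[p]⊆q (there x∈p)) (λ eq → 0≢1+n (sym (f-injective eq)))))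
    (x∈p⇒∣p-x∣<∣p∣ (f[p]⊆q here))

-- Halmos–Vaughan induction on the left side: split along a critical subset if there is one,
-- otherwise match an arbitrary vertex to any of its neighbours.
module Hall {e p n} {E : Fin p → Fin n → Set e} (E? : ∀ l j → Dec (E l j)) where
  open import Data.Nat using (_+_)
  open import Data.Nat.Properties
    using (+-comm; ≤-<-trans; <-≤-trans; ≤-trans; ≤-pred; ≤-reflexive; <⇒≱; ≰⇒>; +-cancelˡ-≤; +-monoˡ-≤;
           module ≤-Reasoning)
  open import Data.Fin.Subset
  open import Data.Fin.Subset.Properties
  open import Data.Vec using (tabulate)
  open import Data.Vec.Properties using (lookup∘tabulate; lookup⇒[]=; []=⇒lookup)
  open import Relation.Nullary using (does)
  open import Relation.Nullary.Decidable using (dec-true)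
  open SubsetCardinality
  open ≡ using (refl; sym; trans; cong; subst)

  private variable
    l : Fin p
    j : Fin n
    S S′ L : Subset p
    R : Subset n

  adjacent? : (S : Subset p) (j : Fin n) → Dec (∃ λ l → l ∈ S × E l j)
  adjacent? S j = any? λ l → l ∈? S ×-dec E? l j

  N : Subset p → Subset n
  N S = tabulate λ j → does (adjacent? S j)

  ∈N⁺ : l ∈ S → E l j → j ∈ N S
  ∈N⁺ {l} {S} {j} l∈S e =
    lookup⇒[]= j (N S) (trans (lookup∘tabulate _ j) (dec-true (adjacent? S j) (l , l∈S , e)))

  ∈N⁻ : j ∈ N S → ∃ λ l → l ∈ S × E l j
  ∈N⁻ {j} {S} j∈N = witness (adjacent? S j) (trans (sym (lookup∘tabulate _ j)) ([]=⇒lookup j∈N))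
    where
    witness : ∀ {a} {A : Set a} (a? : Dec A) → does a? ≡ inside → A
    witness (yes a) _ = a

  N-mono : S ⊆ S′ → N S ⊆ N S′
  N-mono S⊆S′ j∈N with l , l∈S , e ← ∈N⁻ j∈N = ∈N⁺ (S⊆S′ l∈S) e

  HallCondition : Subset p → Subset n → Set
  HallCondition L R = ∀ S → S ⊆ L → ∣ S ∣ ≤ ∣ N S ∩ R ∣

  record Matching (L : Subset p) (R : Subset n) : Set e where
    field
      match           : l ∈ L → Fin n
      match∈R         : (l∈L : l ∈ L) → match l∈L ∈ R
      match-edge      : (l∈L : l ∈ L) → E l (match l∈L)
      match-injective : {l l′ : Fin p} (l∈L : l ∈ L) (l′∈L : l′ ∈ L) → match l∈L ≡ match l′∈L → l ≡ l′

  emptyMatching : Empty L → Matching L R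
  emptyMatching L-empty = record
    { match           = λ l∈L → contradiction (_ , l∈L) L-empty
    ; match∈R         = λ l∈L → contradiction (_ , l∈L) L-empty
    ; match-edge      = λ l∈L → contradiction (_ , l∈L) L-empty
    ; match-injective = λ l∈L _ _ → contradiction (_ , l∈L) L-empty
    }

  singletonMatching : j ∈ R → E l j → Matching ⁅ l ⁆ (⁅ j ⁆ ∩ R)
  singletonMatching {j} {l = l} j∈R e = record
    { match           = λ _ → j
    ; match∈R         = λ _ → x∈p∩q⁺ (x∈⁅x⁆ j , j∈R)
    ; match-edge      = λ l′∈⁅l⁆ → subst (λ l′ → E l′ j) (sym (x∈⁅y⁆⇒x≡y l l′∈⁅l⁆)) e
    ; match-injective = λ l₁∈⁅l⁆ l₂∈⁅l⁆ _ → trans (x∈⁅y⁆⇒x≡y l l₁∈⁅l⁆) (sym (x∈⁅y⁆⇒x≡y l l₂∈⁅l⁆))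
    }

  glue : (S : Subset p) (Q : Subset n) → Matching S (Q ∩ R) → Matching (L ─ S) (R ─ Q) → Matching L R
  glue {R} {L} S Q M₁ M₂ = record
    { match = match ; match∈R = match∈R ; match-edge = match-edge ; match-injective = match-injective }
    where
    module M₁ = Matching M₁
    module M₂ = Matching M₂

    match : l ∈ L → Fin n
    match {l} l∈L with l ∈? S
    ... | yes l∈S = M₁.match l∈S
    ... | no  l∉S = M₂.match (x∈p∧x∉q⇒x∈p─q l∈L l∉S)

    match∈R : (l∈L : l ∈ L) → match l∈L ∈ R
    match∈R {l} l∈L with l ∈? S
    ... | yes l∈S = proj₂ (x∈p∩q⁻ Q R (M₁.match∈R l∈S))
    ... | no  l∉S = p─q⊆p R Q (M₂.match∈R _)

    match-edge : (l∈L : l ∈ L) → E l (match l∈L)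
    match-edge {l} l∈L with l ∈? S
    ... | yes l∈S = M₁.match-edge l∈S
    ... | no  l∉S = M₂.match-edge _

    separated : {l l′ : Fin p} (l∈S : l ∈ S) (l′∈L─S : l′ ∈ L ─ S) → M₁.match l∈S ≢ M₂.match l′∈L─S
    separated l∈S l′∈L─S eq =
      x∈p─q⇒x∉q R Q (M₂.match∈R l′∈L─S) (subst (_∈ Q) eq (proj₁ (x∈p∩q⁻ Q R (M₁.match∈R l∈S))))

    match-injective : {l l′ : Fin p} (l∈L : l ∈ L) (l′∈L : l′ ∈ L) → match l∈L ≡ match l′∈L → l ≡ l′
    match-injective {l} {l′} l∈L l′∈L eq with l ∈? S | l′ ∈? S
    ... | yes l∈S | yes l′∈S = M₁.match-injective l∈S l′∈S eq
    ... | no  _   | no  _    = M₂.match-injective _ _ eq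
    ... | yes l∈S | no  l′∉S = contradiction eq (separated l∈S (x∈p∧x∉q⇒x∈p─q l′∈L l′∉S))
    ... | no  l∉S | yes l′∈S = contradiction (sym eq) (separated l′∈S (x∈p∧x∉q⇒x∈p─q l∈L l∉S))

  Critical : Subset p → Subset n → Subset p → Set
  Critical L R S = S ⊆ L × Nonempty S × ∣ S ∣ < ∣ L ∣ × ∣ N S ∩ R ∣ ≤ ∣ S ∣

  critical? : ∀ L R S → Dec (Critical L R S)
  critical? L R S = S ⊆? L ×-dec nonempty? S ×-dec ∣ S ∣ <? ∣ L ∣ ×-dec ∣ N S ∩ R ∣ ≤? ∣ S ∣

  hallCondition-critical : S ⊆ L → HallCondition L R → HallCondition S (N S ∩ R)
  hallCondition-critical {S} {L} {R} S⊆L hall-LR S′ S′⊆S =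
    ≤-trans (hall-LR S′ (S⊆L ∘ S′⊆S)) (p⊆q⇒∣p∣≤∣q∣ N[S′]∩R⊆N[S]∩R)
    where
    N[S′]∩R⊆N[S]∩R : N S′ ∩ R ⊆ N S′ ∩ (N S ∩ R)
    N[S′]∩R⊆N[S]∩R j∈ with j∈N[S′] , j∈R ← x∈p∩q⁻ (N S′) R j∈ =
      x∈p∩q⁺ (j∈N[S′] , x∈p∩q⁺ (N-mono S′⊆S j∈N[S′] , j∈R))

  -- Apply Hall's condition to S ∪ S′ and discard the at most ∣ S ∣ neighbours of S.
  hallCondition-complement : S ⊆ L → ∣ N S ∩ R ∣ ≤ ∣ S ∣ → HallCondition L R →
                             HallCondition (L ─ S) (R ─ N S)
  hallCondition-complement {S} {L} {R} S⊆L S-tight hall-LR S′ S′⊆L─S = +-cancelˡ-≤ ∣ S ∣ _ _ (begin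
    ∣ S ∣ + ∣ S′ ∣                           ≡⟨ Empty[p∩q]⇒∣p∪q∣≡∣p∣+∣q∣ S S′ disjoint ⟨
    ∣ S ∪ S′ ∣                               ≤⟨ hall-LR (S ∪ S′) S∪S′⊆L ⟩
    ∣ N (S ∪ S′) ∩ R ∣                       ≤⟨ p⊆q⇒∣p∣≤∣q∣ split ⟩
    ∣ (N S ∩ R) ∪ (N S′ ∩ (R ─ N S)) ∣       ≤⟨ ∣p∪q∣≤∣p∣+∣q∣ (N S ∩ R) _ ⟩
    ∣ N S ∩ R ∣ + ∣ N S′ ∩ (R ─ N S) ∣       ≤⟨ +-monoˡ-≤ _ S-tight ⟩
    ∣ S ∣ + ∣ N S′ ∩ (R ─ N S) ∣             ∎)
    where
    open ≤-Reasoning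

    disjoint : Empty (S ∩ S′)
    disjoint (l , l∈S∩S′) with l∈S , l∈S′ ← x∈p∩q⁻ S S′ l∈S∩S′ = x∈p─q⇒x∉q L S (S′⊆L─S l∈S′) l∈S

    S∪S′⊆L : S ∪ S′ ⊆ L
    S∪S′⊆L l∈ with x∈p∪q⁻ S S′ l∈
    ... | inj₁ l∈S  = S⊆L l∈S
    ... | inj₂ l∈S′ = p─q⊆p L S (S′⊆L─S l∈S′)

    split : N (S ∪ S′) ∩ R ⊆ (N S ∩ R) ∪ (N S′ ∩ (R ─ N S))
    split {j} j∈ with x∈p∩q⁻ (N (S ∪ S′)) R j∈ | j ∈? N S
    ... | _   , j∈R | yes j∈N[S] = x∈p∪q⁺ (inj₁ (x∈p∩q⁺ (j∈N[S] , j∈R)))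
    ... | j∈N , j∈R | no  j∉N[S] with ∈N⁻ j∈N
    ... | l , l∈S∪S′ , e with x∈p∪q⁻ S S′ l∈S∪S′
    ... | inj₁ l∈S  = contradiction (∈N⁺ l∈S e) j∉N[S]
    ... | inj₂ l∈S′ = x∈p∪q⁺ (inj₂ (x∈p∩q⁺ (∈N⁺ l∈S′ e , x∈p∧x∉q⇒x∈p─q j∈R j∉N[S])))

  -- Without critical subsets each nonempty S ⊆ L - l has a neighbour to spare, namely j.
  hallCondition-surplus : (∀ S → ¬ Critical L R S) → l ∈ L → HallCondition (L - l) (R - j)
  hallCondition-surplus {L} {R} {l} {j} no-critical l∈L S S⊆L-l with nonempty? S
  ... | no  S-empty    = subst (_≤ ∣ N S ∩ (R - j) ∣) (sym (Empty⇒∣p∣≡0 S-empty)) z≤n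
  ... | yes S-nonempty = ≤-pred (begin
    suc ∣ S ∣                        ≤⟨ ≰⇒> (λ tight → no-critical S (S⊆L , S-nonempty , ∣S∣<∣L∣ , tight)) ⟩
    ∣ N S ∩ R ∣                      ≤⟨ p⊆q⇒∣p∣≤∣q∣ split ⟩
    ∣ (N S ∩ (R - j)) ∪ ⁅ j ⁆ ∣      ≤⟨ ∣p∪q∣≤∣p∣+∣q∣ (N S ∩ (R - j)) ⁅ j ⁆ ⟩
    ∣ N S ∩ (R - j) ∣ + ∣ ⁅ j ⁆ ∣    ≡⟨ cong (∣ N S ∩ (R - j) ∣ +_) (∣⁅x⁆∣≡1 j) ⟩
    ∣ N S ∩ (R - j) ∣ + 1            ≡⟨ +-comm _ 1 ⟩
    suc ∣ N S ∩ (R - j) ∣            ∎)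
    where
    open ≤-Reasoning

    S⊆L : S ⊆ L
    S⊆L = p─q⊆p L ⁅ l ⁆ ∘ S⊆L-l

    ∣S∣<∣L∣ : ∣ S ∣ < ∣ L ∣
    ∣S∣<∣L∣ = ≤-<-trans (p⊆q⇒∣p∣≤∣q∣ S⊆L-l) (x∈p⇒∣p-x∣<∣p∣ l∈L)

    split : N S ∩ R ⊆ (N S ∩ (R - j)) ∪ ⁅ j ⁆
    split {j′} j′∈ with j′ Fin.≟ j
    ... | yes refl = x∈p∪q⁺ (inj₂ (x∈⁅x⁆ j))
    ... | no  j′≢j with j′∈N , j′∈R ← x∈p∩q⁻ (N S) R j′∈ =
      x∈p∪q⁺ (inj₁ (x∈p∩q⁺ (j′∈N , x∈p∧x≢y⇒x∈p-y j′∈R j′≢j)))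

  neighbour : HallCondition L R → l ∈ L → ∃ λ j → j ∈ R × E l j
  neighbour {L} {R} {l} hall-LR l∈L
    with j , j∈ ← 0<∣p∣⇒Nonempty (subst (_≤ ∣ N ⁅ l ⁆ ∩ R ∣) (∣⁅x⁆∣≡1 l) (hall-LR ⁅ l ⁆ (x∈p⇒⁅x⁆⊆p l∈L)))
    with j∈N , j∈R ← x∈p∩q⁻ (N ⁅ l ⁆) R j∈
    with l′ , l′∈⁅l⁆ , e ← ∈N⁻ j∈N
    = j , j∈R , subst (λ l′ → E l′ j) (x∈⁅y⁆⇒x≡y l l′∈⁅l⁆) e

  hall : ∀ s (L : Subset p) (R : Subset n) → ∣ L ∣ ≤ s → HallCondition L R → Matching L R
  hall zero    L R ∣L∣≤0 _ = emptyMatching (λ L-nonempty → <⇒≱ (Nonempty⇒0<∣p∣ L-nonempty) ∣L∣≤0)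
  hall (suc s) L R ∣L∣≤1+s hall-LR with anySubset? (critical? L R)
  ... | yes (S , S⊆L , (l , l∈S) , ∣S∣<∣L∣ , S-tight) =
    glue S (N S)
      (hall s S (N S ∩ R) (≤-pred (<-≤-trans ∣S∣<∣L∣ ∣L∣≤1+s)) (hallCondition-critical S⊆L hall-LR))
      (hall s (L ─ S) (R ─ N S)
        (≤-pred (<-≤-trans (p∩q≢∅⇒∣p─q∣<∣p∣ L S (l , x∈p∩q⁺ (S⊆L l∈S , l∈S))) ∣L∣≤1+s))
        (hallCondition-complement S⊆L S-tight hall-LR))
  ... | no no-critical with nonempty? L
  ...   | no  L-empty     = emptyMatching L-empty
  ...   | yes (l , l∈L) with j , j∈R , e ← neighbour hall-LR l∈L =
    glue ⁅ l ⁆ ⁅ j ⁆ (singletonMatching j∈R e)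
      (hall s (L - l) (R - j) (≤-pred (<-≤-trans (x∈p⇒∣p-x∣<∣p∣ l∈L) ∣L∣≤1+s))
        (hallCondition-surplus (λ S S-critical → no-critical (S , S-critical)) l∈L))

  hall-theorem : (∀ S → ∣ S ∣ ≤ ∣ N S ∣) →
                 Σ (Fin p → Fin n) λ π → Injective _≡_ _≡_ π × (∀ l → E l (π l))
  hall-theorem hall-N = (λ l → match (∈⊤ {x = l})) , match-injective ∈⊤ ∈⊤ , (λ l → match-edge ∈⊤)
    where
    open Matching (hall p ⊤ ⊤ (≤-reflexive (∣⊤∣≡n p))
      (λ S _ → ≤-trans (hall-N S) (p⊆q⇒∣p∣≤∣q∣ {p = N S} (λ j∈N → x∈p∩q⁺ (j∈N , ∈⊤)))))

module _ where
  open import Data.Fin.Properties using (punchIn-punchOut)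
  open import Data.Vec.Functional using (insertAt)
  open import Data.Vec.Functional.Properties using (insertAt-lookup; insertAt-punchIn)
  open ≡ using (refl; sym; trans; cong; subst)

  data PunchView {n} (i : Fin (suc n)) : Fin (suc n) → Set where
    at-pivot : PunchView i i
    punched  : ∀ j → PunchView i (punchIn i j)

  punchView : ∀ {n} (i x : Fin (suc n)) → PunchView i x
  punchView i x with i Fin.≟ x
  ... | yes refl = at-pivot
  ... | no  i≢x  = subst (PunchView i) (punchIn-punchOut i≢x) (punched (punchOut i≢x))

  insertAt-injective : ∀ {n m} {f : Fin n → Fin m} (i : Fin (suc n)) {v : Fin m} →
                       Injective _≡_ _≡_ f → (∀ j → f j ≢ v) → Injective _≡_ _≡_ (insertAt f i v)
  insertAt-injective {f = f} i {v} f-injective f≢v {x} {y} eq with punchView i x | punchView i y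
  ... | at-pivot   | at-pivot   = refl
  ... | at-pivot   | punched y′ =
    contradiction (trans (sym (insertAt-punchIn f i v y′)) (trans (sym eq) (insertAt-lookup f i v)))
                  (f≢v y′)
  ... | punched x′ | at-pivot   =
    contradiction (trans (sym (insertAt-punchIn f i v x′)) (trans eq (insertAt-lookup f i v)))
                  (f≢v x′)
  ... | punched x′ | punched y′ =
    cong (punchIn i)
         (f-injective (trans (sym (insertAt-punchIn f i v x′)) (trans eq (insertAt-punchIn f i v y′))))

module FieldProperties {c ℓ} (F : Field c ℓ) where
  open Field F
  open import Algebra.Properties.Ring ring using (-1*x≈-x; -‿distribˡ-*; //-rightDividesʳ)
  open import Data.Maybe using (nothing)
  open import Relation.Binary.Reasoning.Setoid setoid
  open import Tactic.RingSolver.Core.AlmostCommutativeRing using (fromCommutativeRing)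
  open import Tactic.RingSolver.NonReflective (fromCommutativeRing commRing (λ _ → nothing))
    using (solve; _⊜_; _⊕_; _⊗_)

  x-[x*z]*w≈0 : ∀ x {w z} → w * z ≈ 1# → x + - (x * z) * w ≈ 0#
  x-[x*z]*w≈0 x {w} {z} wz≈1 = begin
    x + - (x * z) * w    ≈⟨ +-congˡ (-‿distribˡ-* (x * z) w) ⟨
    x + - (x * z * w)    ≈⟨ +-congˡ (-‿cong (*-assoc x z w)) ⟩
    x + - (x * (z * w))  ≈⟨ +-congˡ (-‿cong (*-congˡ (trans (*-comm z w) wz≈1))) ⟩
    x + - (x * 1#)       ≈⟨ +-congˡ (-‿cong (*-identityʳ x)) ⟩
    x + - x              ≈⟨ -‿inverseʳ x ⟩
    0#                   ∎

  [x+y]-1*y≈x : ∀ x y → (x + y) + - 1# * y ≈ x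
  [x+y]-1*y≈x x y = trans (+-congˡ (-1*x≈-x y)) (//-rightDividesʳ y x)

  z*[a*x]≈x : ∀ {z a} x → z * a ≈ 1# → z * (a * x) ≈ x
  z*[a*x]≈x {z} {a} x za≈1 = trans (sym (*-assoc z a x)) (trans (*-congʳ za≈1) (*-identityˡ x))

  -- The solver cannot cancel - g + g, so - g enters it as an atom.
  a*b+r≈[a-g]*b+[g*b+r] : ∀ a g b r → a * b + r ≈ (a + - g) * b + (g * b + r)
  a*b+r≈[a-g]*b+[g*b+r] a g b r = sym (begin
    (a + - g) * b + (g * b + r)   ≈⟨ solve 5 (λ a g -g b r → ((a ⊕ -g) ⊗ b ⊕ (g ⊗ b ⊕ r))
                                                             ⊜ ((a ⊗ b ⊕ r) ⊕ (-g ⊕ g) ⊗ b))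
                                               refl a g (- g) b r ⟩
    (a * b + r) + (- g + g) * b   ≈⟨ +-congˡ (trans (*-congʳ (-‿inverseˡ g)) (zeroˡ b)) ⟩
    (a * b + r) + 0#              ≈⟨ +-identityʳ _ ⟩
    a * b + r                     ∎)

module VectorSpace {c ℓ} (F : Field c ℓ) (m : ℕ) where
  open Field F hiding (zero)
  open FieldProperties F
  open LinAlg F m
  open import Algebra.Definitions.RawMonoid +-rawMonoid using (sum)
  open import Algebra.Properties.CommutativeSemigroup +-commutativeSemigroup using (interchange; x∙yz≈y∙xz)
  open import Algebra.Properties.Ring ring using (-0#≈0#)
  open import Data.Nat.Properties using (m≤n⇒m≤1+n; 1+n≰n)
  open import Data.Vec.Functional using (head; tail; insertAt; removeAt)
  open import Data.Vec.Functional.Properties using (insertAt-lookup; insertAt-punchIn)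
  open import Data.Vec.Functional.Relation.Binary.Equality.Setoid setoid using (≋-sym; ≋-trans)
  open import Relation.Binary.Reasoning.Setoid setoid

  private variable
    j : ℕ

  InSpan : (Fin j → V) → V → Set (c ⊔ ℓ)
  InSpan {j} vs v = Σ (Fin j → Carrier) λ a → lincomb a vs ≈ᵥ v

  +ᵥ-dropˡ : ∀ {a} v u → a ≈ 0# → ((a ·ᵥ v) +ᵥ u) ≈ᵥ u
  +ᵥ-dropˡ v u a≈0 k = trans (+-congʳ (trans (*-congʳ a≈0) (zeroˡ (v k)))) (+-identityˡ (u k))

  +ᵥ-dropʳ : ∀ {a} v u → a ≈ 0# → (u +ᵥ (a ·ᵥ v)) ≈ᵥ u
  +ᵥ-dropʳ v u a≈0 k = trans (+-congˡ (trans (*-congʳ a≈0) (zeroˡ (v k)))) (+-identityʳ (u k))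

  lincomb-cong : ∀ {a b : Fin j → Carrier} vs → (∀ l → a l ≈ b l) → lincomb a vs ≈ᵥ lincomb b vs
  lincomb-cong {zero}  vs a≈b k = refl
  lincomb-cong {suc j} vs a≈b k = +-cong (*-congʳ (a≈b zero)) (lincomb-cong (tail vs) (a≈b ∘ suc) k)

  lincomb-zero : ∀ {a : Fin j → Carrier} vs → (∀ l → a l ≈ 0#) → lincomb a vs ≈ᵥ 0ᵥ
  lincomb-zero {zero}  vs a≈0 k = refl
  lincomb-zero {suc j} {a} vs a≈0 k =
    trans (+ᵥ-dropˡ (vs zero) (lincomb (tail a) (tail vs)) (a≈0 zero) k) (lincomb-zero (tail vs) (a≈0 ∘ suc) k)

  lincomb-+ : ∀ (a b : Fin j → Carrier) vs → lincomb (λ l → a l + b l) vs ≈ᵥ (lincomb a vs +ᵥ lincomb b vs)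
  lincomb-+ {zero}  a b vs k = sym (+-identityˡ 0#)
  lincomb-+ {suc j} a b vs k =
    trans (+-cong (distribʳ _ _ _) (lincomb-+ (tail a) (tail b) (tail vs) k)) (interchange _ _ _ _)

  lincomb-* : ∀ r (a : Fin j → Carrier) vs → lincomb (λ l → r * a l) vs ≈ᵥ (r ·ᵥ lincomb a vs)
  lincomb-* {zero}  r a vs k = sym (zeroʳ r)
  lincomb-* {suc j} r a vs k =
    trans (+-cong (*-assoc _ _ _) (lincomb-* r (tail a) (tail vs) k)) (sym (distribˡ _ _ _))

  lincomb-+ᵥ : ∀ (a : Fin j → Carrier) us ws →
               lincomb a (λ l → us l +ᵥ ws l) ≈ᵥ (lincomb a us +ᵥ lincomb a ws)
  lincomb-+ᵥ {zero}  a us ws k = sym (+-identityˡ 0#)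
  lincomb-+ᵥ {suc j} a us ws k =
    trans (+-cong (distribˡ _ _ _) (lincomb-+ᵥ (tail a) (tail us) (tail ws) k)) (interchange _ _ _ _)

  lincomb-·ᵥ : ∀ (a r : Fin j → Carrier) v → lincomb a (λ l → r l ·ᵥ v) ≈ᵥ (sum (λ l → a l * r l) ·ᵥ v)
  lincomb-·ᵥ {zero}  a r v k = sym (zeroˡ _)
  lincomb-·ᵥ {suc j} a r v k =
    trans (+-cong (sym (*-assoc _ _ _)) (lincomb-·ᵥ (tail a) (tail r) v k)) (sym (distribʳ _ _ _))

  lincomb-removeAt : ∀ (a : Fin (suc j) → Carrier) vs l₀ →
                     lincomb a vs ≈ᵥ ((a l₀ ·ᵥ vs l₀) +ᵥ lincomb (removeAt a l₀) (removeAt vs l₀))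
  lincomb-removeAt         a vs zero     k = refl
  lincomb-removeAt {suc j} a vs (suc l₀) k =
    trans (+-congˡ (lincomb-removeAt (tail a) (tail vs) l₀ k)) (x∙yz≈y∙xz _ _ _)

  lincomb-head≈0 : ∀ (a : Fin (suc j) → Carrier) vs → head a ≈ 0# →
                   lincomb a vs ≈ᵥ lincomb (tail a) (tail vs)
  lincomb-head≈0 a vs = +ᵥ-dropˡ (head vs) (lincomb (tail a) (tail vs))

  lincomb-∈ : ∀ (A : Subspace) a (vs : Fin j → V) → (∀ l → vs l ∈ A) → lincomb a vs ∈ A
  lincomb-∈ {zero}  A a vs vs∈A = 0∈ A
  lincomb-∈ {suc j} A a vs vs∈A =
    +∈ A (·∈ A (head a) (vs∈A zero)) (lincomb-∈ A (tail a) (tail vs) (vs∈A ∘ suc))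

  δ : Fin (suc j) → Fin (suc j) → Carrier
  δ l = insertAt (λ _ → 0#) l 1#

  lincomb-δ : ∀ (vs : Fin (suc j) → V) l → lincomb (δ l) vs ≈ᵥ vs l
  lincomb-δ vs l k = begin
    lincomb (δ l) vs k                                            ≈⟨ lincomb-removeAt (δ l) vs l k ⟩
    δ l l * vs l k + lincomb (removeAt (δ l) l) (removeAt vs l) k
      ≈⟨ +-cong (*-congʳ (reflexive (insertAt-lookup _ l 1#)))
                (lincomb-zero (removeAt vs l) (λ x → reflexive (insertAt-punchIn _ l 1# x)) k) ⟩
    1# * vs l k + 0#                                              ≈⟨ +-identityʳ _ ⟩
    1# * vs l k                                                   ≈⟨ *-identityˡ _ ⟩
    vs l k                                                        ∎

  spans⇒∈ : ∀ (A : Subspace) (vs : Fin j → V) → Spans vs A → ∀ l → vs l ∈ A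
  spans⇒∈ {suc j} A vs vs-spans l = proj₂ (vs-spans (vs l)) (δ l , lincomb-δ vs l)

  span : (Fin j → V) → Subspace
  span vs = record
    { _∈S  = InSpan vs
    ; resp = λ { u≈v (a , a≈u) → a , ≋-trans a≈u u≈v }
    ; 0∈   = (λ _ → 0#) , lincomb-zero vs (λ _ → refl)
    ; +∈   = λ { (a , a≈u) (b , b≈v) →
                 (λ l → a l + b l) , ≋-trans (lincomb-+ a b vs) (λ k → +-cong (a≈u k) (b≈v k)) }
    ; ·∈   = λ { r (a , a≈v) → (λ l → r * a l) , ≋-trans (lincomb-* r a vs) (λ k → *-congˡ (a≈v k)) }
    }

  spans-span : (vs : Fin j → V) → Spans vs (span vs)
  spans-span vs v = (λ v∈ → v∈) , (λ v∈ → v∈)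

  span-⊑ : ∀ (A : Subspace) (vs : Fin j → V) → (∀ l → vs l ∈ A) → span vs ⊑ A
  span-⊑ A vs vs∈A v (a , a≈v) = resp A a≈v (lincomb-∈ A a vs vs∈A)

  ∈-+-cancelʳ : ∀ (A : Subspace) {u v} → (u +ᵥ v) ∈ A → v ∈ A → u ∈ A
  ∈-+-cancelʳ A {u} {v} u+v∈A v∈A = resp A (λ k → [x+y]-1*y≈x (u k) (v k)) (+∈ A u+v∈A (·∈ A (- 1#) v∈A))

  ∈-·-cancel : ∀ (A : Subspace) {a v} → ¬ a ≈ 0# → (a ·ᵥ v) ∈ A → v ∈ A
  ∈-·-cancel A {a} {v} a≉0 av∈A with z , a*z≈1 ← inverse a a≉0 =
    resp A (λ k → z*[a*x]≈x (v k) (trans (*-comm z a) a*z≈1)) (·∈ A z av∈A)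

  coefficient≈0 : ∀ (A : Subspace) {u v r a} → u ∈ A → r ∈ A → ¬ v ∈ A → u ≈ᵥ ((a ·ᵥ v) +ᵥ r) → a ≈ 0#
  coefficient≈0 A {a = a} u∈A r∈A v∉A u≈av+r with a ≟ 0#
  ... | yes a≈0 = a≈0
  ... | no  a≉0 = contradiction (∈-·-cancel A a≉0 (∈-+-cancelʳ A (resp A u≈av+r u∈A) r∈A)) v∉A

  pivot : (bs : Fin (suc j) → V) (l₀ : Fin (suc j)) (μ : Fin j → Carrier) → Fin j → V
  pivot bs l₀ μ l = removeAt bs l₀ l +ᵥ (μ l ·ᵥ bs l₀)

  pivot-≈ : ∀ (bs : Fin (suc j) → V) l₀ μ l → μ l ≈ 0# → pivot bs l₀ μ l ≈ᵥ removeAt bs l₀ l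
  pivot-≈ bs l₀ μ l = +ᵥ-dropʳ (bs l₀) (removeAt bs l₀ l)

  lincomb-pivot : ∀ (a : Fin j → Carrier) bs l₀ μ →
    lincomb a (pivot bs l₀ μ) ≈ᵥ ((sum (λ l → a l * μ l) ·ᵥ bs l₀) +ᵥ lincomb a (removeAt bs l₀))
  lincomb-pivot a bs l₀ μ k = trans (lincomb-+ᵥ a (removeAt bs l₀) (λ l → μ l ·ᵥ bs l₀) k)
                                    (trans (+-congˡ (lincomb-·ᵥ a μ (bs l₀) k)) (+-comm _ _))

  lincomb-pivot≈lincomb-insertAt : ∀ (a : Fin j → Carrier) bs l₀ μ →
    lincomb a (pivot bs l₀ μ) ≈ᵥ lincomb (insertAt a l₀ (sum (λ l → a l * μ l))) bs
  lincomb-pivot≈lincomb-insertAt a bs l₀ μ k = begin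
    lincomb a (pivot bs l₀ μ) k                                   ≈⟨ lincomb-pivot a bs l₀ μ k ⟩
    g * bs l₀ k + lincomb a (removeAt bs l₀) k
      ≈⟨ +-cong (*-congʳ (reflexive (insertAt-lookup a l₀ g)))
                (lincomb-cong (removeAt bs l₀) (λ l → reflexive (insertAt-punchIn a l₀ g l)) k) ⟨
    a′ l₀ * bs l₀ k + lincomb (removeAt a′ l₀) (removeAt bs l₀) k ≈⟨ lincomb-removeAt a′ bs l₀ k ⟨
    lincomb a′ bs k                                               ∎
    where
    g : Carrier
    g = sum (λ l → a l * μ l)
    a′ : Fin (suc _) → Carrier
    a′ = insertAt a l₀ g

  pivot-independent : ∀ (bs : Fin (suc j) → V) l₀ μ → LinIndep bs → LinIndep (pivot bs l₀ μ)
  pivot-independent bs l₀ μ bs-independent a a≈0 l =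
    trans (reflexive (≡.sym (insertAt-punchIn a l₀ g l)))
          (bs-independent (insertAt a l₀ g) (≋-trans (≋-sym (lincomb-pivot≈lincomb-insertAt a bs l₀ μ)) a≈0)
                          (punchIn l₀ l))
    where
    g : Carrier
    g = sum (λ l → a l * μ l)

  lincomb≈lincomb-pivot : ∀ (a : Fin (suc j) → Carrier) bs l₀ μ →
    let a′ = removeAt a l₀ in
    lincomb a bs ≈ᵥ (((a l₀ + - sum (λ l → a′ l * μ l)) ·ᵥ bs l₀) +ᵥ lincomb a′ (pivot bs l₀ μ))
  lincomb≈lincomb-pivot a bs l₀ μ k = begin
    lincomb a bs k                                            ≈⟨ lincomb-removeAt a bs l₀ k ⟩
    a l₀ * bs l₀ k + lincomb a′ (removeAt bs l₀) k            ≈⟨ a*b+r≈[a-g]*b+[g*b+r] _ g _ _ ⟩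
    (a l₀ + - g) * bs l₀ k + (g * bs l₀ k + lincomb a′ (removeAt bs l₀) k)
                                                              ≈⟨ +-congˡ (lincomb-pivot a′ bs l₀ μ k) ⟨
    (a l₀ + - g) * bs l₀ k + lincomb a′ (pivot bs l₀ μ) k    ∎
    where
    a′ : Fin _ → Carrier
    a′ = removeAt a l₀
    g : Carrier
    g = sum (λ l → a′ l * μ l)

  -- Gaussian elimination of the coordinate along head vs from all bs l, pivoting on bs l₀.
  module Elimination {q j} (vs : Fin (suc q) → V) (bs : Fin (suc j) → V)
                     (α : Fin (suc j) → Fin (suc q) → Carrier) (α-represents : ∀ l → lincomb (α l) vs ≈ᵥ bs l)
                     (l₀ : Fin (suc j)) (α₀≉0 : ¬ α l₀ zero ≈ 0#) where

    private
      z : Carrier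
      z = proj₁ (inverse (α l₀ zero) α₀≉0)

    μ : Fin j → Carrier
    μ l = - (α (punchIn l₀ l) zero * z)

    eliminated : Fin j → V
    eliminated = pivot bs l₀ μ

    μ≈0 : ∀ l → α (punchIn l₀ l) zero ≈ 0# → μ l ≈ 0#
    μ≈0 l α≈0 = trans (-‿cong (trans (*-congʳ α≈0) (zeroˡ z))) -0#≈0#

    eliminated-InSpan : ∀ l → InSpan (tail vs) (eliminated l)
    eliminated-InSpan l = tail β , λ k → begin
      lincomb (tail β) (tail vs) k                              ≈⟨ lincomb-head≈0 β vs β₀≈0 k ⟨
      lincomb β vs k
        ≈⟨ lincomb-+ (α l′) (λ s → μ l * α l₀ s) vs k ⟩
      lincomb (α l′) vs k + lincomb (λ s → μ l * α l₀ s) vs k   ≈⟨ +-congˡ (lincomb-* (μ l) (α l₀) vs k) ⟩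
      lincomb (α l′) vs k + μ l * lincomb (α l₀) vs k
        ≈⟨ +-cong (α-represents l′ k) (*-congˡ (α-represents l₀ k)) ⟩
      eliminated l k                                            ∎
      where
      l′ : Fin (suc j)
      l′ = punchIn l₀ l
      β : Fin (suc q) → Carrier
      β s = α l′ s + μ l * α l₀ s
      β₀≈0 : head β ≈ 0#
      β₀≈0 = x-[x*z]*w≈0 (α l′ zero) (proj₂ (inverse (α l₀ zero) α₀≉0))

  steinitz : ∀ {q p} (vs : Fin q → V) (ws : Fin p → V) → LinIndep ws → (∀ l → InSpan vs (ws l)) → p ≤ q
  steinitz {p = zero} vs ws _ _ = z≤n
  steinitz {zero} {suc p} vs ws ws-independent ws∈span = contradiction
    (trans (sym (reflexive (insertAt-lookup {n = p} (λ _ → 0#) zero 1#)))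
           (ws-independent (δ zero) (≋-trans (lincomb-δ ws zero) (≋-sym (proj₂ (ws∈span zero)))) zero))
    1≉0
  steinitz {suc q} {suc p} vs ws ws-independent ws∈span with any? (λ l → ¬? (head (proj₁ (ws∈span l)) ≟ 0#))
  ... | yes (l₀ , α₀≉0) =
    s≤s (steinitz (tail vs) eliminated (pivot-independent ws l₀ μ ws-independent) eliminated-InSpan)
    where open Elimination vs ws (proj₁ ∘ ws∈span) (proj₂ ∘ ws∈span) l₀ α₀≉0
  ... | no  no-pivot    = m≤n⇒m≤1+n (steinitz (tail vs) ws ws-independent ws∈span-tail)
    where
    ws∈span-tail : ∀ l → InSpan (tail vs) (ws l)
    ws∈span-tail l = tail α , ≋-trans (≋-sym (lincomb-head≈0 α vs α₀≈0)) (proj₂ (ws∈span l))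
      where
      α : Fin (suc q) → Carrier
      α = proj₁ (ws∈span l)
      α₀≈0 : head α ≈ 0#
      α₀≈0 = decidable-stable (head α ≟ 0#) (λ α₀≉0 → no-pivot (l , α₀≉0))

  longer-independent-escapes : ∀ (A : Subspace) {d} → (∀ v → Dec (v ∈ A)) → HasDim A d →
                               (ws : Fin (suc d) → V) → LinIndep ws → ∃ λ l → ¬ ws l ∈ A
  longer-independent-escapes A {d} A? (xs , _ , xs-spans) ws ws-independent with any? (λ l → ¬? (A? (ws l)))
  ... | yes escape = escape
  ... | no  none   = contradiction (steinitz xs ws ws-independent ws∈span) (1+n≰n {d})
    where
    ws∈span : ∀ l → InSpan xs (ws l)
    ws∈span l = proj₁ (xs-spans (ws l)) (decidable-stable (A? (ws l)) (λ ws-l∉A → none (l , ws-l∉A)))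

module SubspaceMembership {c ℓ} (F : Field c ℓ) where
  open Field F hiding (zero)
  open FieldProperties F
  open module LinAlg′ {m} = LinAlg F m using (Subspace; _∈_; resp; 0∈; +∈; ·∈; _+ᵥ_; _·ᵥ_)
  open import Data.Vec.Functional using (_∷_; head; tail)
  open import Data.Fin.Properties using (sequence)
  open import Effect.Monad using (RawMonad)
  open import Relation.Nullary.Decidable using (map′; ¬¬-excluded-middle)
  open import Relation.Nullary.Negation using (¬¬-Monad)
  open RawMonad (¬¬-Monad {a = c ⊔ ℓ})

  tailSubspace : ∀ {p} → Subspace {suc p} → Subspace {p}
  tailSubspace A = record
    { _∈S  = λ v → (0# ∷ v) ∈ A
    ; resp = λ v≈w → resp A λ { zero → refl ; (suc k) → v≈w k }
    ; 0∈   = resp A (λ { zero → refl ; (suc k) → refl }) (0∈ A)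
    ; +∈   = λ u∈ v∈ → resp A (λ { zero → +-identityˡ 0# ; (suc k) → refl }) (+∈ A u∈ v∈)
    ; ·∈   = λ a v∈ → resp A (λ { zero → zeroʳ a ; (suc k) → refl }) (·∈ A a v∈)
    }

  -- Induction on the dimension, after classically deciding whether some w ∈ A has a nonzero
  -- head: if so, v ∈ A iff v - (head v / head w) w ∈ A, a vector with zero head.
  ∈-¬¬-decidable : ∀ p (A : Subspace {p}) → ¬ ¬ (∀ v → Dec (v ∈ A))
  ∈-¬¬-decidable zero    A = pure λ v → yes (resp A (λ ()) (0∈ A))
  ∈-¬¬-decidable (suc p) A = do
    tail? ← ∈-¬¬-decidable p (tailSubspace A)
    pivot? ← ¬¬-excluded-middle
    pure (decide tail? pivot?)
    where
    open VectorSpace F (suc p) using (∈-+-cancelʳ)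

    tail∈⇒∈ : ∀ {u} → head u ≈ 0# → tail u ∈ tailSubspace A → u ∈ A
    tail∈⇒∈ u₀≈0 = resp A λ { zero → sym u₀≈0 ; (suc k) → refl }

    ∈⇒tail∈ : ∀ {u} → head u ≈ 0# → u ∈ A → tail u ∈ tailSubspace A
    ∈⇒tail∈ u₀≈0 = resp A λ { zero → u₀≈0 ; (suc k) → refl }

    decide : (∀ v → Dec (v ∈ tailSubspace A)) → Dec (∃ λ w → w ∈ A × ¬ head w ≈ 0#) → ∀ v → Dec (v ∈ A)
    decide tail? (yes (w , w∈A , w₀≉0)) v =
      map′ (λ tail-u∈ → ∈-+-cancelʳ A (tail∈⇒∈ u₀≈0 tail-u∈) κw∈A) (λ v∈A → ∈⇒tail∈ u₀≈0 (+∈ A v∈A κw∈A))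
           (tail? (tail u))
      where
      z : Carrier
      z = proj₁ (inverse (head w) w₀≉0)
      κ : Carrier
      κ = - (head v * z)
      κw∈A : (κ ·ᵥ w) ∈ A
      κw∈A = ·∈ A κ w∈A
      u : Fin (suc p) → Carrier
      u = v +ᵥ (κ ·ᵥ w)
      u₀≈0 : head u ≈ 0#
      u₀≈0 = x-[x*z]*w≈0 (head v) (proj₂ (inverse (head w) w₀≉0))
    decide tail? (no no-pivot) v with head v ≟ 0#
    ... | no  v₀≉0 = no λ v∈A → no-pivot (v , v∈A , v₀≉0)
    ... | yes v₀≈0 = map′ (tail∈⇒∈ v₀≈0) (∈⇒tail∈ v₀≈0) (tail? (tail v))

  ∈-¬¬-decidable-family : ∀ {m n} (X : Fin n → Subspace {m}) → ¬ ¬ (∀ j v → Dec (v ∈ X j))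
  ∈-¬¬-decidable-family {m} X = sequence rawApplicative (λ j → ∈-¬¬-decidable m (X j))

module Flat {c ℓ} (F : Field c ℓ) (m : ℕ) {n} (X : Fin n → LinAlg.Subspace F m)
            (X? : ∀ j v → Dec (LinAlg._∈_ F m v (X j))) (i : Fin n) where
  open Field F hiding (zero)
  open LinAlg F m
  open Transversal X
  open VectorSpace F m
  open SubsetCardinality using (injective⇒∣p∣≤∣q∣)
  open import Algebra.Definitions.RawMonoid +-rawMonoid using (sum)
  open import Data.Fin.Subset using (∣_∣) renaming (_∈_ to _∈ₛ_)
  open import Data.Fin.Subset.Properties using () renaming (_∈?_ to _∈ₛ?_)
  open import Data.Vec using ([])
  open import Data.Vec.Functional using (_∷_; tail; insertAt; removeAt)
  open import Data.Vec.Functional.Properties using (insertAt-lookup; insertAt-punchIn)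
  open import Data.Vec.Functional.Relation.Binary.Equality.Setoid setoid using (≋-sym; ≋-trans)

  module Extension {k} (T : Subspace) (t : Fin k → V) (t-basis : IsBasis T k t) (T⊑Xi : T ⊑ X i)
                   (T-independent : Independent T) (y : V) (y∉Xi : ¬ y ∈ X i) where

    T′ : Subspace
    T′ = span (y ∷ t)

    t∈T : ∀ s → t s ∈ T
    t∈T = spans⇒∈ T t (proj₂ t-basis)

    T⊑T′ : T ⊑ T′
    T⊑T′ v v∈T with a , a≈v ← proj₁ (proj₂ t-basis v) v∈T =
      (0# ∷ a) , ≋-trans (lincomb-head≈0 (0# ∷ a) (y ∷ t) refl) a≈v

    y∷t-independent : LinIndep (y ∷ t)
    y∷t-independent a a≈0 = λ { zero → a₀≈0 ; (suc s) → proj₁ t-basis (tail a) rest≈0 s }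
      where
      a₀≈0 : a zero ≈ 0#
      a₀≈0 = coefficient≈0 (X i) (0∈ (X i)) (T⊑Xi _ (lincomb-∈ T (tail a) t t∈T)) y∉Xi (≋-sym a≈0)
      rest≈0 : lincomb (tail a) t ≈ᵥ 0ᵥ
      rest≈0 = ≋-trans (≋-sym (lincomb-head≈0 a (y ∷ t) a₀≈0)) a≈0

    module Coordinates {j} (bs : Fin j → V) (bs-basis : IsBasis T′ j bs) where

      α : Fin j → Fin (suc k) → Carrier
      α l = proj₁ (spans⇒∈ T′ bs (proj₂ bs-basis) l)

      α-represents : ∀ l → lincomb (α l) (y ∷ t) ≈ᵥ bs l
      α-represents l = proj₂ (spans⇒∈ T′ bs (proj₂ bs-basis) l)

      rest∈Xi : ∀ l → lincomb (tail (α l)) t ∈ X i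
      rest∈Xi l = T⊑Xi _ (lincomb-∈ T (tail (α l)) t t∈T)

      α≈0 : ∀ l → bs l ∈ X i → α l zero ≈ 0#
      α≈0 l bs-l∈Xi = coefficient≈0 (X i) bs-l∈Xi (rest∈Xi l) y∉Xi (≋-sym (α-represents l))

      α≉0 : ∀ l → ¬ bs l ∈ X i → ¬ α l zero ≈ 0#
      α≉0 l bs-l∉Xi αl≈0 =
        bs-l∉Xi (resp (X i) (≋-trans (≋-sym (lincomb-head≈0 (α l) (y ∷ t) αl≈0)) (α-represents l))
                            (rest∈Xi l))

      some-∉Xi : ∃ λ l → ¬ bs l ∈ X i
      some-∉Xi with any? (λ l → ¬? (X? i (bs l)))
      ... | yes found = found
      ... | no  none  = contradiction (span-⊑ (X i) bs bs∈Xi y (proj₁ (proj₂ bs-basis y) y∈T′)) y∉Xi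
        where
        bs∈Xi : ∀ l → bs l ∈ X i
        bs∈Xi l = decidable-stable (X? i (bs l)) (λ bs-l∉Xi → none (l , bs-l∉Xi))
        y∈T′ : y ∈ T′
        y∈T′ = spans⇒∈ T′ (y ∷ t) (spans-span (y ∷ t)) zero

      open Hall (λ l j′ → ¬? (X? j′ (bs l))) public using (N; ∈N⁺; hall-theorem)

    module AtPivot {j} (bs : Fin (suc j) → V) (bs-basis : IsBasis T′ (suc j) bs)
                   {l₀ : Fin (suc j)} (l₀∉Xi : ¬ bs l₀ ∈ X i) where
      open Coordinates bs bs-basis
      open Elimination (y ∷ t) bs α α-represents l₀ (α≉0 l₀ l₀∉Xi)

      eliminated∈T : ∀ l → eliminated l ∈ T
      eliminated∈T l = span-⊑ T t t∈T _ (eliminated-InSpan l)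

      -- The pivot coefficient w vanishes because v and C lie in T ⊑ X i while bs l₀ does not.
      InSpan-eliminated : ∀ {v} → v ∈ T → InSpan eliminated v
      InSpan-eliminated {v} v∈T with a , a≈v ← proj₁ (proj₂ bs-basis v) (T⊑T′ v v∈T) =
        a′ , ≋-sym (≋-trans v≈wb₀+C (+ᵥ-dropˡ (bs l₀) C w≈0))
        where
        a′ : Fin j → Carrier
        a′ = removeAt a l₀
        C : V
        C = lincomb a′ eliminated
        w : Carrier
        w = a l₀ + - sum (λ l → a′ l * μ l)
        v≈wb₀+C : v ≈ᵥ ((w ·ᵥ bs l₀) +ᵥ C)
        v≈wb₀+C = ≋-trans (≋-sym a≈v) (lincomb≈lincomb-pivot a bs l₀ μ)
        w≈0 : w ≈ 0#
        w≈0 = coefficient≈0 (X i) (T⊑Xi v v∈T) (T⊑Xi C (lincomb-∈ T a′ eliminated eliminated∈T)) l₀∉Xi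
                            v≈wb₀+C

      eliminated-basis : IsBasis T j eliminated
      eliminated-basis = pivot-independent bs l₀ μ (proj₁ bs-basis)
                       , λ v → InSpan-eliminated , span-⊑ T eliminated eliminated∈T v

      π₀ : Fin j → Fin n
      π₀ = proj₁ (T-independent j eliminated eliminated-basis)

      π₀-injective : Injective _≡_ _≡_ π₀
      π₀-injective = proj₁ (proj₂ (T-independent j eliminated eliminated-basis))

      eliminated∉Xπ₀ : ∀ l → ¬ eliminated l ∈ X (π₀ l)
      eliminated∉Xπ₀ = proj₂ (proj₂ (T-independent j eliminated eliminated-basis))

      π₀≢i : ∀ l → π₀ l ≢ i
      π₀≢i l π₀l≡i =
        eliminated∉Xπ₀ l (≡.subst (λ j′ → eliminated l ∈ X j′) (≡.sym π₀l≡i) (T⊑Xi _ (eliminated∈T l)))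

      φ : Fin (suc j) → Fin n
      φ = insertAt π₀ l₀ i

      -- The implicit arguments are spelled out: inferring them makes type checking very slow.
      φ-injective : Injective _≡_ _≡_ φ
      φ-injective = insertAt-injective {f = π₀} l₀ {v = i} π₀-injective π₀≢i

      pivot-∉Xπ₀ : ∀ l → bs (punchIn l₀ l) ∈ X (π₀ l) → ¬ bs l₀ ∈ X (π₀ l)
      pivot-∉Xπ₀ l b∈X b₀∈X = eliminated∉Xπ₀ l (+∈ (X (π₀ l)) b∈X (·∈ (X (π₀ l)) (μ l) b₀∈X))

      ∈Xi⇒∉Xπ₀ : ∀ l → bs (punchIn l₀ l) ∈ X i → ¬ bs (punchIn l₀ l) ∈ X (π₀ l)
      ∈Xi⇒∉Xπ₀ l b∈Xi b∈X =
        eliminated∉Xπ₀ l (resp (X (π₀ l)) (≋-sym (pivot-≈ bs l₀ μ l (μ≈0 l (α≈0 _ b∈Xi)))) b∈X)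

      φ-into-N : ∀ S → (l₀ ∈ₛ S ⊎ (∀ {x} → x ∈ₛ S → bs x ∈ X i)) → ∀ {x} → x ∈ₛ S → φ x ∈ₛ N S
      φ-into-N S pivot-or-inside {x} = into (punchView l₀ x)
        where
        into : ∀ {x} → PunchView l₀ x → x ∈ₛ S → φ x ∈ₛ N S
        into at-pivot    l₀∈S = ≡.subst (_∈ₛ N S) (≡.sym (insertAt-lookup π₀ l₀ i)) (∈N⁺ l₀∈S l₀∉Xi)
        into (punched l) x∈S  = ≡.subst (_∈ₛ N S) (≡.sym (insertAt-punchIn π₀ l₀ i l))
                                        (π₀-into-N (X? (π₀ l) (bs (punchIn l₀ l))) pivot-or-inside)
          where
          π₀-into-N : Dec (bs (punchIn l₀ l) ∈ X (π₀ l)) → (l₀ ∈ₛ S ⊎ (∀ {x} → x ∈ₛ S → bs x ∈ X i)) →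
                      π₀ l ∈ₛ N S
          π₀-into-N (no  b∉X) _                  = ∈N⁺ x∈S b∉X
          π₀-into-N (yes b∈X) (inj₁ l₀∈S)        = ∈N⁺ l₀∈S (pivot-∉Xπ₀ l b∈X)
          π₀-into-N (yes b∈X) (inj₂ S-inside-Xi) = contradiction b∈X (∈Xi⇒∉Xπ₀ l (S-inside-Xi x∈S))

      hallCondition-at : ∀ S → (l₀ ∈ₛ S ⊎ (∀ {x} → x ∈ₛ S → bs x ∈ X i)) → ∣ S ∣ ≤ ∣ N S ∣
      hallCondition-at S pivot-or-inside =
        injective⇒∣p∣≤∣q∣ {f = φ} φ-injective S (N S) (φ-into-N S pivot-or-inside)

    hallCondition : ∀ {j} (bs : Fin j → V) (bs-basis : IsBasis T′ j bs) S →
                    ∣ S ∣ ≤ ∣ Coordinates.N bs bs-basis S ∣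
    hallCondition {zero}  bs _        [] = z≤n
    hallCondition {suc j} bs bs-basis S with any? (λ x → x ∈ₛ? S ×-dec ¬? (X? i (bs x)))
    ... | yes (l₀ , l₀∈S , l₀∉Xi) = AtPivot.hallCondition-at bs bs-basis l₀∉Xi S (inj₁ l₀∈S)
    ... | no  none =
      AtPivot.hallCondition-at bs bs-basis (proj₂ (Coordinates.some-∉Xi bs bs-basis)) S (inj₂ S-inside-Xi)
      where
      S-inside-Xi : ∀ {x} → x ∈ₛ S → bs x ∈ X i
      S-inside-Xi {x} x∈S = decidable-stable (X? i (bs x)) (λ bs-x∉Xi → none (x , x∈S , bs-x∉Xi))

    T′-independent : Independent T′
    T′-independent j bs bs-basis = Coordinates.hall-theorem bs bs-basis (hallCondition bs bs-basis)

  flat : IsFlat (X i)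
  flat Y d k k′ Xi⊑Y Xi-dim (ws , ws-basis) ((T , T⊑Xi , T-independent , t , t-basis) , _)
       (_ , Y-rank-bound)
    with l , ws-l∉Xi ← longer-independent-escapes (X i) (X? i) Xi-dim ws (proj₁ ws-basis) =
    Y-rank-bound T′ (suc k) T′⊑Y T′-independent (ws l ∷ t , y∷t-independent , spans-span (ws l ∷ t))
    where
    open Extension T t t-basis T⊑Xi T-independent (ws l) ws-l∉Xi
    T′⊑Y : T′ ⊑ Y
    T′⊑Y = span-⊑ Y (ws l ∷ t) λ where
      zero    → spans⇒∈ Y ws (proj₂ ws-basis) l
      (suc s) → Xi⊑Y _ (T⊑Xi _ (t∈T s))

theorem22 : ∀ {c ℓ : Level} (F : Field c ℓ) (m n : ℕ) (X : Fin n → LinAlg.Subspace F m) (i : Fin n)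
            → LinAlg.Transversal.IsFlat F m X (X i)
theorem22 F m n X i Y d k k′ Xi⊑Y Xi-dim Y-dim Xi-rank Y-rank =
  decidable-stable (k <? k′)
    (¬¬-map (λ X? → Flat.flat F m X X? i Y d k k′ Xi⊑Y Xi-dim Y-dim Xi-rank Y-rank)
            (SubspaceMembership.∈-¬¬-decidable-family F X))
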